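{- Let $S$ be a set of integers and $N\in\mathbb{N}$. Let $A=\{a_1, \ldots , a_d\}\subset [1,N]$ be a set of distinct integers with $H(0; a_1, \ldots, a_d) \subset S \cap [1,N]$. If $h\in\mathbb{N}$ and $d \ge 5h+4$, then \[ d \le 5\big(h!\, f(N)\, g(h, N)\big)^{1/h} + 5h + 4. \]
   Context: $H(0;a_1,\dots,a_d)=\{\sum_{i=1}^d \varepsilon_i a_i : \varepsilon_i\in\{0,1\},\ \sum_i \varepsilon_i>0\}$. $f(N)$ is the least number such that whenever $B_1, \ldots, B_5 \subset \mathbb{N}$ satisfy $B_i+B_j \subset S \cap [1, N]$ for all distinct $i, j \in \{1, \ldots, 5\}$, then $\min_{1 \le i \le 5} |B_i| \le f(N)$. For the set $A$, $r_{A,h}(n)$ is the number of ways of writing $n$ as a sum of exactly $h$ elements of $A$, where the order of the summands is irrelevant, and $g(h, N)=\max_{n \le N} r_{A, h}(n)$. -}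

module Defs where

open import Data.Nat using (ℕ; zero; suc; _+_; _*_; _∸_; _≤_; _⊔_; _≟_)
open import Data.Integer using (ℤ; +_)
open import Data.Bool using (Bool; true; false)
open import Data.Fin using (Fin; zero; suc)
open import Data.Vec using (Vec; []; _∷_)
open import Data.List using (List; []; _∷_; [_]; map; concatMap; upTo; length; filter; foldr)
open import Data.List.Membership.Propositional using (_∈_)
open import Data.List.Relation.Unary.Unique.Propositional using (Unique)
open import Data.Product using (_×_; ∃)
open import Relation.Binary.PropositionalEquality using (_≡_; _≢_)

InSN : (ℤ → Set) → ℕ → ℕ → Set
InSN S N n = S (+ n) × (1 ≤ n × n ≤ N)

subsetSum : {d : ℕ} → (Fin d → Bool) → (Fin d → ℕ) → ℕ
subsetSum {zero}  ε a = 0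
subsetSum {suc d} ε a =
  (if₀ ε zero then a zero) + subsetSum (λ i → ε (suc i)) (λ i → a (suc i))
  where
  if₀_then_ : Bool → ℕ → ℕ
  if₀ true  then x = x
  if₀ false then x = 0

-- f(N): m is a valid bound in the definition of f(N) (relative to S) if whenever
-- finite sets B_1,…,B_5 ⊂ ℕ (duplicate-free lists) satisfy B_i + B_j ⊂ S ∩ [1,N]
-- for all distinct i, j, then min_i |B_i| ≤ m.  f(N) is the least such m.
IsFBound : (ℤ → Set) → ℕ → ℕ → Set
IsFBound S N m =
  (B : Fin 5 → List ℕ) →
  (∀ i → Unique (B i)) →
  (∀ i j → i ≢ j → ∀ {x y} → x ∈ B i → y ∈ B j → InSN S N (x + y)) →
  ∃ λ i → length (B i) ≤ m

-- all multiplicity vectors (c_1,…,c_d) ∈ ℕ^d with c_1 + … + c_d = h,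
-- i.e. all multisets of size h drawn from the index set {1,…,d}
multisets : (d : ℕ) → ℕ → List (Vec ℕ d)
multisets zero    zero    = [ [] ]
multisets zero    (suc h) = []
multisets (suc d) h =
  concatMap (λ k → map (k ∷_) (multisets d (h ∸ k))) (upTo (suc h))

weighted : {d : ℕ} → Vec ℕ d → (Fin d → ℕ) → ℕ
weighted []       a = 0
weighted (c ∷ cs) a = c * a zero + weighted cs (λ i → a (suc i))

r : {d : ℕ} → (Fin d → ℕ) → ℕ → ℕ → ℕ
r {d} a h n = length (filter (λ c → weighted c a ≟ n) (multisets d h))

g : {d : ℕ} → (Fin d → ℕ) → ℕ → ℕ → ℕ
g a h N = foldr _⊔_ 0 (map (r a h) (upTo (suc N)))

-- Write d = 5t + e with e ≤ 4 and split the indices into five consecutive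
-- blocks of length t (plus a tail of length e).  For each block i let B_i be the set
-- of sums of h distinct a_k with k in block i.  For i ≠ j an element of B_i + B_j is
-- the subset sum of a nonempty subset (the disjoint union of the two h-subsets), so
-- B_i + B_j ⊂ S ∩ [1,N]; hence some |B_i| ≤ m.  Every x ∈ B_i is at most N and arises
-- from at most r_{A,h}(x) ≤ g(h,N) of the C(t,h) h-subsets of block i, so by double
-- counting C(t,h) ≤ m · g(h,N).  Finally (t ∸ h)^h ≤ h! C(t,h) and d ∸ (5h+4) ≤ 5(t ∸ h).
module Submission where

open import Defs
open import Data.Nat using (ℕ; zero; suc; _+_; _*_; _∸_; _^_; _≤_; _<_; _!; _⊔_; _≟_; _≤?_; z≤n; s≤s)
open import Data.Nat.Properties
open import Data.Nat.Combinatorics using (_C_; nCk≡nPk/k!; nCk+nC[k+1]≡[n+1]C[k+1]; nPk≡n!/[n∸k]!)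
open import Data.Nat.Combinatorics.Base using (_P_; _P′_)
open import Data.Nat.Combinatorics.Specification using (k!∣nP′k; nP′k≡n!/[n∸k]!)
open import Data.Nat.DivMod using (_/_; _%_; m*[n/m]≡n; m≡m%n+[m/n]*n; m%n<n)
open import Data.Integer using (ℤ)
open import Data.Bool using (Bool; true; false; if_then_else_; _∧_; _∨_)
open import Data.Bool.Properties using (∧-zeroʳ)
open import Data.Fin using (Fin; zero; suc)
open import Data.Vec using (Vec; []; _∷_; _++_; replicate; zipWith) renaming (map to mapᵥ; lookup to lookupᵥ)
open import Data.Vec.Properties using (++-injectiveˡ; ++-injectiveʳ; ∷-injectiveˡ; ∷-injectiveʳ)
open import Data.Vec.Relation.Binary.Pointwise.Inductive using (Pointwise; []; _∷_) renaming (++⁺ to pointwise-++)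
open import Data.List using (List; []; _∷_; [_]; map; filter; length; upTo; deduplicate; foldr) renaming (_++_ to _++ₗ_)
open import Data.List.Properties using (length-map; length-++; length-removeAt′)
open import Data.List.Membership.Propositional using (_∈_; _─_; lose)
open import Data.List.Membership.Propositional.Properties
  using (∈-map⁺; ∈-map⁻; ∈-++⁻; ∈-filter⁺; ∈-filter⁻; ∈-concatMap⁺; ∈-upTo⁺; ∈-deduplicate⁺; ∈-deduplicate⁻)
open import Data.List.Relation.Unary.Any using (here; there; index)
import Data.List.Relation.Unary.All as All
open import Data.List.Relation.Unary.AllPairs using ([]; _∷_)
open import Data.List.Relation.Unary.Unique.Propositional using (Unique)
import Data.List.Relation.Unary.Unique.Propositional.Properties as Unique
open import Data.List.Relation.Unary.Unique.DecPropositional.Properties _≟_ using (deduplicate-!)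
open import Data.Product using (_×_; _,_; ∃; proj₁; proj₂)
open import Data.Sum using (inj₁; inj₂)
open import Data.Empty using (⊥-elim)
open import Function using (_∘_)
open import Function.Definitions using (Injective)
open import Relation.Nullary using (¬_; does; yes; no)
open import Relation.Unary using (Decidable)
open import Relation.Unary.Properties using (∁?)
open import Relation.Binary.PropositionalEquality hiding ([_])
open import Algebra.Properties.CommutativeSemigroup +-commutativeSemigroup using (interchange)

module _ {A : Set} where

  ∈-─ : ∀ {x z : A} {ys} (x∈ys : x ∈ ys) → z ∈ ys → z ≢ x → z ∈ ys ─ x∈ys
  ∈-─ (here refl)  (here refl)  z≢x = ⊥-elim (z≢x refl)
  ∈-─ (here _)     (there z∈ys) _   = z∈ys
  ∈-─ (there _)    (here z≡y)   _   = here z≡y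
  ∈-─ (there x∈ys) (there z∈ys) z≢x = there (∈-─ x∈ys z∈ys z≢x)

  unique-⊆-length : ∀ {xs ys : List A} → Unique xs → (∀ {z} → z ∈ xs → z ∈ ys) →
                    length xs ≤ length ys
  unique-⊆-length {[]}     _               _     = z≤n
  unique-⊆-length {x ∷ xs} {ys} (x∉xs ∷ uniq) xs⊆ys = begin
      suc (length xs)          ≤⟨ s≤s (unique-⊆-length uniq rest⊆) ⟩
      suc (length (ys ─ x∈ys)) ≡⟨ length-removeAt′ ys (index x∈ys) ⟨
      length ys                ∎
    where
    open ≤-Reasoning
    x∈ys : x ∈ ys
    x∈ys = xs⊆ys (here refl)
    rest⊆ : ∀ {z} → z ∈ xs → z ∈ ys ─ x∈ys
    rest⊆ z∈xs = ∈-─ x∈ys (xs⊆ys (there z∈xs)) (≢-sym (All.lookup x∉xs z∈xs))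

  length-filter-split : ∀ {P : A → Set} (P? : Decidable P) xs →
                        length xs ≡ length (filter P? xs) + length (filter (∁? P?) xs)
  length-filter-split P? []       = refl
  length-filter-split P? (x ∷ xs) with does (P? x)
  ... | true  = cong suc (length-filter-split P? xs)
  ... | false = trans (cong suc (length-filter-split P? xs)) (sym (+-suc _ _))

  fibre-count : (w : A → ℕ) (F : ℕ → List A) {G : ℕ} (B : List ℕ) {T : List A} →
                Unique T →
                (∀ {c} → c ∈ T → w c ∈ B × c ∈ F (w c)) →
                (∀ {x} → x ∈ B → length (F x) ≤ G) →
                length T ≤ length B * G
  fibre-count w F []      {[]}    _ _        _ = z≤n
  fibre-count w F []      {c ∷ _} _ labelled _ with proj₁ (labelled (here refl))
  ... | ()
  fibre-count w F {G} (b ∷ B) {T} uniq labelled small = begin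
      length T                                                  ≡⟨ length-filter-split over-b T ⟩
      length (filter over-b T) + length (filter (∁? over-b) T) ≤⟨ +-mono-≤ fibre-over-b rest ⟩
      G + length B * G                                          ∎
    where
    open ≤-Reasoning
    over-b : Decidable (λ c → w c ≡ b)
    over-b c = w c ≟ b

    fibre-over-b : length (filter over-b T) ≤ G
    fibre-over-b = ≤-trans (unique-⊆-length (Unique.filter⁺ over-b uniq) in-F-b) (small (here refl))
      where
      in-F-b : ∀ {c} → c ∈ filter over-b T → c ∈ F b
      in-F-b c∈ with c∈T , wc≡b ← ∈-filter⁻ over-b c∈ =
        subst (λ x → _ ∈ F x) wc≡b (proj₂ (labelled c∈T))

    rest : length (filter (∁? over-b) T) ≤ length B * G
    rest = fibre-count w F B (Unique.filter⁺ (∁? over-b) uniq) relabel (λ x∈B → small (there x∈B))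
      where
      relabel : ∀ {c} → c ∈ filter (∁? over-b) T → w c ∈ B × c ∈ F (w c)
      relabel c∈ with c∈T , wc≢b ← ∈-filter⁻ (∁? over-b) c∈ with labelled c∈T
      ... | here wc≡b  , _   = ⊥-elim (wc≢b wc≡b)
      ... | there wc∈B , c∈F = wc∈B , c∈F

≤-maximum : ∀ {x} xs → x ∈ xs → x ≤ foldr _⊔_ 0 xs
≤-maximum (y ∷ ys) (here refl)  = m≤m⊔n y _
≤-maximum (y ∷ ys) (there x∈ys) = ≤-trans (≤-maximum ys x∈ys) (m≤n⊔m y _)

bit : Bool → ℕ
bit b = if b then 1 else 0

toN : ∀ {n} → Vec Bool n → Vec ℕ n
toN = mapᵥ bit

toN-injective : ∀ {n} {u v : Vec Bool n} → toN u ≡ toN v → u ≡ v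
toN-injective {u = []}    {[]}    _  = refl
toN-injective {u = x ∷ u} {y ∷ v} eq = cong₂ _∷_ (bit-injective x y (∷-injectiveˡ eq)) (toN-injective (∷-injectiveʳ eq))
  where
  bit-injective : ∀ x y → bit x ≡ bit y → x ≡ y
  bit-injective true  true  _  = refl
  bit-injective false false _  = refl
  bit-injective true  false ()
  bit-injective false true  ()

size : ∀ {n} → Vec ℕ n → ℕ
size c = weighted c (λ _ → 1)

size-toN-++ : ∀ {m n} (u : Vec Bool m) (v : Vec Bool n) → size (toN (u ++ v)) ≡ size (toN u) + size (toN v)
size-toN-++ []      v = refl
size-toN-++ (x ∷ u) v = trans (cong (bit x * 1 +_) (size-toN-++ u v)) (sym (+-assoc (bit x * 1) _ _))

size-empty : ∀ n → size (toN (replicate n false)) ≡ 0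
size-empty zero    = refl
size-empty (suc n) = size-empty n

subsets : (t h : ℕ) → List (Vec Bool t)
subsets t       zero    = [ replicate t false ]
subsets zero    (suc h) = []
subsets (suc t) (suc h) = map (true ∷_) (subsets t h) ++ₗ map (false ∷_) (subsets t (suc h))

subsets-length : ∀ t h → length (subsets t h) ≡ t C h
subsets-length t       zero    = refl
subsets-length zero    (suc h) = refl
subsets-length (suc t) (suc h) = begin
    length (map (true ∷_) (subsets t h) ++ₗ map (false ∷_) (subsets t (suc h)))
      ≡⟨ length-++ (map (true ∷_) (subsets t h)) ⟩
    length (map (true ∷_) (subsets t h)) + length (map (false ∷_) (subsets t (suc h)))
      ≡⟨ cong₂ _+_ (length-map (true ∷_) (subsets t h)) (length-map (false ∷_) (subsets t (suc h))) ⟩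
    length (subsets t h) + length (subsets t (suc h))
      ≡⟨ cong₂ _+_ (subsets-length t h) (subsets-length t (suc h)) ⟩
    t C h + t C suc h
      ≡⟨ nCk+nC[k+1]≡[n+1]C[k+1] t h ⟩
    suc t C suc h ∎
  where open ≡-Reasoning

subsets-size : ∀ t h {v} → v ∈ subsets t h → size (toN v) ≡ h
subsets-size t       zero    (here refl) = size-empty t
subsets-size zero    (suc h) ()
subsets-size (suc t) (suc h) v∈ with ∈-++⁻ (map (true ∷_) (subsets t h)) v∈
... | inj₁ v∈₁ with u , u∈ , refl ← ∈-map⁻ (true ∷_) v∈₁  = cong suc (subsets-size t h u∈)
... | inj₂ v∈₂ with u , u∈ , refl ← ∈-map⁻ (false ∷_) v∈₂ = subsets-size t (suc h) u∈

subsets-unique : ∀ t h → Unique (subsets t h)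
subsets-unique t       zero    = All.[] ∷ []
subsets-unique zero    (suc h) = []
subsets-unique (suc t) (suc h) =
  Unique.++⁺ (Unique.map⁺ ∷-injectiveʳ (subsets-unique t h))
             (Unique.map⁺ ∷-injectiveʳ (subsets-unique t (suc h)))
             first-entries-differ
  where
  first-entries-differ : ∀ {v} → ¬ (v ∈ map (true ∷_) (subsets t h) × v ∈ map (false ∷_) (subsets t (suc h)))
  first-entries-differ (v∈₁ , v∈₂) with ∈-map⁻ (true ∷_) v∈₁ | ∈-map⁻ (false ∷_) v∈₂
  ... | _ , _ , refl | _ , _ , ()

-- Each of the h factors of the falling factorial t P′ h = t (t-1) ⋯ (t-h+1) is ≥ t ∸ h.
power≤falling : ∀ t h → (t ∸ h) ^ h ≤ t P′ h
power≤falling t zero    = ≤-refl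
power≤falling t (suc h) =
  *-mono-≤ (∸-monoʳ-≤ t (n≤1+n h))
           (≤-trans (^-monoˡ-≤ h (∸-monoʳ-≤ t (n≤1+n h))) (power≤falling t h))

-- (t ∸ h)^h ≤ h! · C(t,h), because h! · C(t,h) is the falling factorial (or h > t).
power≤factorial*binomial : ∀ t h → (t ∸ h) ^ h ≤ h ! * (t C h)
power≤factorial*binomial t h with h ≤? t
... | yes h≤t = begin
    (t ∸ h) ^ h            ≤⟨ power≤falling t h ⟩
    t P′ h                 ≡⟨ m*[n/m]≡n (k!∣nP′k h≤t) ⟨
    h ! * ((t P′ h) / h !) ≡⟨ cong (λ p → h ! * (p / h !)) P≡P′ ⟨
    h ! * ((t P h) / h !)  ≡⟨ cong (h ! *_) (nCk≡nPk/k! h≤t) ⟨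
    h ! * (t C h)          ∎
  where
  open ≤-Reasoning
  instance _ = h !≢0
  P≡P′ : t P h ≡ t P′ h
  P≡P′ = trans (nPk≡n!/[n∸k]! h≤t) (sym (nP′k≡n!/[n∸k]! h≤t))
... | no h≰t = subst (_≤ h ! * (t C h)) (sym (vanishes (≰⇒> h≰t))) z≤n
  where
  vanishes : ∀ {t h} → t < h → (t ∸ h) ^ h ≡ 0
  vanishes {t} {suc h} t<h rewrite m≤n⇒m∸n≡0 (<⇒≤ t<h) = refl

weighted-+ : ∀ {n} (c c′ : Vec ℕ n) (a : Fin n → ℕ) →
             weighted (zipWith _+_ c c′) a ≡ weighted c a + weighted c′ a
weighted-+ []      []       a = refl
weighted-+ (x ∷ c) (y ∷ c′) a = begin
    (x + y) * a zero + weighted (zipWith _+_ c c′) (a ∘ suc)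
      ≡⟨ cong₂ _+_ (*-distribʳ-+ (a zero) x y) (weighted-+ c c′ (a ∘ suc)) ⟩
    (x * a zero + y * a zero) + (weighted c (a ∘ suc) + weighted c′ (a ∘ suc))
      ≡⟨ interchange (x * a zero) (y * a zero) _ _ ⟩
    (x * a zero + weighted c (a ∘ suc)) + (y * a zero + weighted c′ (a ∘ suc)) ∎
  where open ≡-Reasoning

Disjoint : ∀ {n} → Vec Bool n → Vec Bool n → Set
Disjoint = Pointwise (λ x y → x ∧ y ≡ false)

disjoint-emptyˡ : ∀ {n} (v : Vec Bool n) → Disjoint (replicate n false) v
disjoint-emptyˡ []      = []
disjoint-emptyˡ (_ ∷ v) = refl ∷ disjoint-emptyˡ v

disjoint-emptyʳ : ∀ {n} (u : Vec Bool n) → Disjoint u (replicate n false)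
disjoint-emptyʳ []      = []
disjoint-emptyʳ (x ∷ u) = ∧-zeroʳ x ∷ disjoint-emptyʳ u

toN-∪ : ∀ {n} {u v : Vec Bool n} → Disjoint u v → toN (zipWith _∨_ u v) ≡ zipWith _+_ (toN u) (toN v)
toN-∪ []                                           = refl
toN-∪ {u = x ∷ _} {y ∷ _} (x∧y≡false ∷ disjoint) = cong₂ _∷_ (bit-∨ x y x∧y≡false) (toN-∪ disjoint)
  where
  bit-∨ : ∀ x y → x ∧ y ≡ false → bit (x ∨ y) ≡ bit x + bit y
  bit-∨ true  true  ()
  bit-∨ true  false _ = refl
  bit-∨ false y     _ = refl

weighted-∪ : ∀ {n} {u v : Vec Bool n} → Disjoint u v → (a : Fin n → ℕ) →
             weighted (toN (zipWith _∨_ u v)) a ≡ weighted (toN u) a + weighted (toN v) a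
weighted-∪ {u = u} {v} disjoint a =
  trans (cong (λ c → weighted c a) (toN-∪ disjoint)) (weighted-+ (toN u) (toN v) a)

subsetSum-toN : ∀ {n} (v : Vec Bool n) (a : Fin n → ℕ) → subsetSum (lookupᵥ v) a ≡ weighted (toN v) a
subsetSum-toN []          a = refl
subsetSum-toN (true ∷ v)  a = cong₂ _+_ (sym (+-identityʳ (a zero))) (subsetSum-toN v (a ∘ suc))
subsetSum-toN (false ∷ v) a = subsetSum-toN v (a ∘ suc)

nonempty-member : ∀ {n} (v : Vec Bool n) → 1 ≤ size (toN v) → ∃ λ k → lookupᵥ v k ≡ true
nonempty-member []          ()
nonempty-member (true ∷ v)  _   = zero , refl
nonempty-member (false ∷ v) 1≤s with k , vk ← nonempty-member v 1≤s = suc k , vk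

∈-multisets : ∀ {d} (c : Vec ℕ d) → c ∈ multisets d (size c)
∈-multisets []              = here refl
∈-multisets {suc d} (k ∷ c) = ∈-concatMap⁺ (λ j → map (j ∷_) (multisets d (s ∸ j))) (lose k∈range (∈-map⁺ (k ∷_) c∈))
  where
  s : ℕ
  s = k * 1 + size c
  k≤s : k ≤ s
  k≤s = subst (_≤ s) (*-identityʳ k) (m≤m+n (k * 1) (size c))
  k∈range : k ∈ upTo (suc s)
  k∈range = ∈-upTo⁺ (s≤s k≤s)
  remaining : s ∸ k ≡ size c
  remaining = trans (cong (λ j → j + size c ∸ k) (*-identityʳ k)) (m+n∸m≡n k (size c))
  c∈ : c ∈ multisets d (s ∸ k)
  c∈ = subst (λ j → c ∈ multisets d j) (sym remaining) (∈-multisets c)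

-- the number of indices in n consecutive blocks of length t followed by a tail of length e
blocks : ℕ → ℕ → ℕ → ℕ
blocks zero    t e = e
blocks (suc n) t e = t + blocks n t e

blocks-length : ∀ n t e → blocks n t e ≡ n * t + e
blocks-length zero    t e = refl
blocks-length (suc n) t e = trans (cong (t +_) (blocks-length n t e)) (sym (+-assoc t (n * t) e))

module Blocks (t e : ℕ) where

  place : ∀ {n} → Fin n → Vec Bool t → Vec Bool (blocks n t e)
  place {suc n} zero    v = v ++ replicate (blocks n t e) false
  place {suc n} (suc i) v = replicate t false ++ place i v

  place-size : ∀ {n} (i : Fin n) (v : Vec Bool t) → size (toN (place i v)) ≡ size (toN v)
  place-size {suc n} zero v =
    trans (size-toN-++ v (replicate (blocks n t e) false))
          (trans (cong (size (toN v) +_) (size-empty (blocks n t e))) (+-identityʳ _))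
  place-size {suc n} (suc i) v =
    trans (size-toN-++ (replicate t false) (place i v))
          (trans (cong (_+ size (toN (place i v))) (size-empty t)) (place-size i v))

  place-injective : ∀ {n} (i : Fin n) {u v : Vec Bool t} → place i u ≡ place i v → u ≡ v
  place-injective {suc n} zero    {u} {v} eq = ++-injectiveˡ u v eq
  place-injective {suc n} (suc i)         eq =
    place-injective i (++-injectiveʳ (replicate t false) (replicate t false) eq)

  place-disjoint : ∀ {n} {i j : Fin n} → i ≢ j → (u v : Vec Bool t) → Disjoint (place i u) (place j v)
  place-disjoint {suc n} {zero}  {zero}  i≢j u v = ⊥-elim (i≢j refl)
  place-disjoint {suc n} {zero}  {suc j} i≢j u v =
    pointwise-++ (disjoint-emptyʳ u) (disjoint-emptyˡ (place j v))
  place-disjoint {suc n} {suc i} {zero}  i≢j u v =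
    pointwise-++ (disjoint-emptyˡ v) (disjoint-emptyʳ (place i u))
  place-disjoint {suc n} {suc i} {suc j} i≢j u v =
    pointwise-++ (disjoint-emptyˡ (replicate t false)) (place-disjoint (i≢j ∘ cong suc) u v)

module SumSets (S : ℤ → Set) (N n t e h : ℕ) (a : Fin (blocks n t e) → ℕ)
  (hyp : ∀ (ε : Fin (blocks n t e) → Bool) → ∃ (λ k → ε k ≡ true) → InSN S N (subsetSum ε a))
  (h≥1 : 1 ≤ h) where

  open Blocks t e

  sum-in-SN : ∀ (v : Vec Bool (blocks n t e)) → 1 ≤ size (toN v) → InSN S N (weighted (toN v) a)
  sum-in-SN v 1≤s = subst (InSN S N) (subsetSum-toN v a) (hyp (lookupᵥ v) (nonempty-member v 1≤s))

  placed-size : ∀ (i : Fin n) {v} → v ∈ subsets t h → size (toN (place i v)) ≡ h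
  placed-size i {v} v∈ = trans (place-size i v) (subsets-size t h v∈)

  T : Fin n → List (Vec ℕ (blocks n t e))
  T i = map (toN ∘ place i) (subsets t h)

  B : Fin n → List ℕ
  B i = deduplicate _≟_ (map (λ c → weighted c a) (T i))

  B-element : ∀ i {x} → x ∈ B i → ∃ λ v → v ∈ subsets t h × x ≡ weighted (toN (place i v)) a
  B-element i x∈
    with c , c∈ , refl ← ∈-map⁻ (λ c → weighted c a) (∈-deduplicate⁻ _≟_ (map (λ c → weighted c a) (T i)) x∈)
    with v , v∈ , refl ← ∈-map⁻ (toN ∘ place i) c∈ = v , v∈ , refl

  B-unique : ∀ i → Unique (B i)
  B-unique i = deduplicate-! (map (λ c → weighted c a) (T i))

  -- B_i + B_j ⊂ S ∩ [1,N] for i ≠ j: x + y is the sum over a disjoint union of two h-subsets.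
  B-sums : ∀ i j → i ≢ j → ∀ {x y} → x ∈ B i → y ∈ B j → InSN S N (x + y)
  B-sums i j i≢j x∈ y∈ with u , u∈ , refl ← B-element i x∈ | v , v∈ , refl ← B-element j y∈ =
    subst (InSN S N) (weighted-∪ disjoint a) (sum-in-SN (zipWith _∨_ (place i u) (place j v)) nonempty)
    where
    disjoint : Disjoint (place i u) (place j v)
    disjoint = place-disjoint i≢j u v
    nonempty : 1 ≤ size (toN (zipWith _∨_ (place i u) (place j v)))
    nonempty = subst (1 ≤_)
      (sym (trans (weighted-∪ disjoint (λ _ → 1)) (cong₂ _+_ (placed-size i u∈) (placed-size j v∈))))
      (≤-trans h≥1 (m≤m+n h h))

  -- Double counting: each x ∈ B_i is ≤ N and is the sum of at most r_{A,h}(x) ≤ g(h,N)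
  -- of the C(t,h) h-subsets of block i.
  B-count : ∀ i → t C h ≤ length (B i) * g a h N
  B-count i = begin
      t C h                  ≡⟨ T-length ⟨
      length (T i)           ≤⟨ fibre-count (λ c → weighted c a) representations (B i) T-unique labelled small ⟩
      length (B i) * g a h N ∎
    where
    open ≤-Reasoning
    representations : ℕ → List (Vec ℕ (blocks n t e))
    representations x = filter (λ c → weighted c a ≟ x) (multisets (blocks n t e) h)

    T-length : length (T i) ≡ t C h
    T-length = trans (length-map (toN ∘ place i) (subsets t h)) (subsets-length t h)

    T-unique : Unique (T i)
    T-unique = Unique.map⁺ (place-injective i ∘ toN-injective) (subsets-unique t h)

    labelled : ∀ {c} → c ∈ T i → weighted c a ∈ B i × c ∈ representations (weighted c a)
    labelled c∈ with v , v∈ , refl ← ∈-map⁻ (toN ∘ place i) c∈ =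
      ∈-deduplicate⁺ _≟_ (∈-map⁺ (λ c → weighted c a) c∈) ,
      ∈-filter⁺ (λ c → weighted c a ≟ _)
        (subst (λ s → toN (place i v) ∈ multisets _ s) (placed-size i v∈) (∈-multisets (toN (place i v))))
        refl

    small : ∀ {x} → x ∈ B i → length (representations x) ≤ g a h N
    small x∈ with v , v∈ , refl ← B-element i x∈ =
      ≤-maximum (map (r a h) (upTo (suc N))) (∈-map⁺ (r a h) (∈-upTo⁺ (s≤s x≤N)))
      where
      x≤N : weighted (toN (place i v)) a ≤ N
      x≤N = proj₂ (proj₂ (sum-in-SN (place i v) (subst (1 ≤_) (sym (placed-size i v∈)) h≥1)))

-- With five blocks, the defining property of m bounds some |B_i| by m, so C(t,h) ≤ m · g(h,N).
binomial-bound : (S : ℤ → Set) (N t e : ℕ) (a : Fin (blocks 5 t e) → ℕ) →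
                 (∀ (ε : Fin (blocks 5 t e) → Bool) → ∃ (λ k → ε k ≡ true) → InSN S N (subsetSum ε a)) →
                 (h : ℕ) → 1 ≤ h → (m : ℕ) → IsFBound S N m →
                 t C h ≤ m * g a h N
binomial-bound S N t e a hyp h h≥1 m bound = via-small-set (bound B B-unique B-sums)
  where
  open SumSets S N 5 t e h a hyp h≥1
  via-small-set : ∃ (λ i → length (B i) ≤ m) → t C h ≤ m * g a h N
  via-small-set (i , |Bᵢ|≤m) = ≤-trans (B-count i) (*-monoˡ-≤ (g a h N) |Bᵢ|≤m)

-- d = 5 ⌊d/5⌋ + (d mod 5): five blocks of length ⌊d/5⌋ and a tail of length ≤ 4
five-blocks : ∀ d → ∃ λ t → ∃ λ e → e ≤ 4 × d ≡ blocks 5 t e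
five-blocks d = d / 5 , d % 5 , ≤-pred (m%n<n d 5) , (begin
    d                        ≡⟨ m≡m%n+[m/n]*n d 5 ⟩
    d % 5 + d / 5 * 5        ≡⟨ +-comm (d % 5) (d / 5 * 5) ⟩
    d / 5 * 5 + d % 5        ≡⟨ cong (_+ d % 5) (*-comm (d / 5) 5) ⟩
    5 * (d / 5) + d % 5      ≡⟨ blocks-length 5 (d / 5) (d % 5) ⟨
    blocks 5 (d / 5) (d % 5) ∎)
  where open ≡-Reasoning

excess≤ : ∀ t e h → e ≤ 4 → blocks 5 t e ∸ (5 * h + 4) ≤ 5 * (t ∸ h)
excess≤ t e h e≤4 = begin
    blocks 5 t e ∸ (5 * h + 4) ≡⟨ cong (_∸ (5 * h + 4)) (blocks-length 5 t e) ⟩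
    5 * t + e ∸ (5 * h + 4)    ≤⟨ ∸-monoˡ-≤ (5 * h + 4) (+-monoʳ-≤ (5 * t) e≤4) ⟩
    5 * t + 4 ∸ (5 * h + 4)    ≡⟨ cong₂ _∸_ (+-comm (5 * t) 4) (+-comm (5 * h) 4) ⟩
    4 + 5 * t ∸ (4 + 5 * h)    ≡⟨ [m+n]∸[m+o]≡n∸o 4 (5 * t) (5 * h) ⟩
    5 * t ∸ 5 * h              ≡⟨ *-distribˡ-∸ 5 t h ⟨
    5 * (t ∸ h)                ∎
  where open ≤-Reasoning

*-^ : ∀ k x h → (k * x) ^ h ≡ k ^ h * x ^ h
*-^ k x zero    = refl
*-^ k x (suc h) = trans (cong (k * x *_) (*-^ k x h)) ([m*n]*[o*p]≡[m*o]*[n*p] k x (k ^ h) (x ^ h))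

lemma10 : (S : ℤ → Set) (N d : ℕ) (a : Fin d → ℕ) →
          Injective _≡_ _≡_ a →
          (∀ i → 1 ≤ a i × a i ≤ N) →
          (∀ (ε : Fin d → Bool) → ∃ (λ i → ε i ≡ true) → InSN S N (subsetSum ε a)) →
          (h : ℕ) → 1 ≤ h → 5 * h + 4 ≤ d →
          (m : ℕ) → IsFBound S N m →
          (d ∸ (5 * h + 4)) ^ h ≤ 5 ^ h * (h !) * m * g a h N
lemma10 S N d a _ _ hyp h h≥1 _ m bound with t , e , e≤4 , refl ← five-blocks d = begin
    (blocks 5 t e ∸ (5 * h + 4)) ^ h ≤⟨ ^-monoˡ-≤ h (excess≤ t e h e≤4) ⟩
    (5 * (t ∸ h)) ^ h                ≡⟨ *-^ 5 (t ∸ h) h ⟩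
    5 ^ h * (t ∸ h) ^ h              ≤⟨ *-monoʳ-≤ (5 ^ h) (power≤factorial*binomial t h) ⟩
    5 ^ h * (h ! * (t C h))          ≤⟨ *-monoʳ-≤ (5 ^ h) (*-monoʳ-≤ (h !) (binomial-bound S N t e a hyp h h≥1 m bound)) ⟩
    5 ^ h * (h ! * (m * G))          ≡⟨ *-assoc (5 ^ h) (h !) (m * G) ⟨
    5 ^ h * h ! * (m * G)            ≡⟨ *-assoc (5 ^ h * h !) m G ⟨
    5 ^ h * h ! * m * G              ∎
  where
  open ≤-Reasoning
  G = g a h N
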